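{- Let $S$ and $T$ be maps (each of whose iterates has finitely many fixed points) such that $\mathcal O_{S\times T}(n)=1$ for all $n\ge1$. Then there is a set $P$ of primes for which $\mathcal O_T=s_P$ and $\mathcal O_S=s_{P^c}$, where $P^c$ is the set of all primes not in $P$.
   Context: For a map $R$, $\mathcal O_R(n)$ is the number of closed orbits of $R$ of length $n$, i.e. sets $\{x,Rx,\dots,R^{n-1}x\}$ with $R^nx=x$ of cardinality exactly $n$; $S\times T$ is the Cartesian product map $(x,y)\mapsto(Sx,Ty)$. For a set $P$ of primes, $s_P(n)=0$ if $p\mid n$ for some $p\in P$, and $s_P(n)=1$ otherwise. -}

module Defs where

open import Data.Nat using (ℕ; zero; suc; _≤_; _<_)
open import Data.Nat.Divisibility using (_∣_)
open import Data.Nat.Primality using (Prime)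
open import Data.Fin using (Fin)
open import Data.Vec using (Vec; lookup)
open import Data.List using (List)
open import Data.List.Relation.Unary.Unique.Propositional using (Unique)
open import Data.List.Membership.Propositional using (_∈_)
open import Data.Product using (Σ; ∃; _×_; _,_)
open import Function.Bundles using (_⇔_)
open import Relation.Nullary using (¬_)
open import Relation.Binary.PropositionalEquality using (_≡_; _≢_)

iter : {A : Set} → (A → A) → ℕ → A → A
iter R zero    x = x
iter R (suc n) x = R (iter R n x)

_⊗_ : {A B : Set} → (A → A) → (B → B) → A × B → A × B
(S ⊗ T) (x , y) = S x , T y

FinitelyManyFixedPoints : {A : Set} → (A → A) → Set
FinitelyManyFixedPoints {A} R =
  ∀ n → 1 ≤ n → Σ (List A) λ L → Unique L × (∀ x → (x ∈ L) ⇔ (iter R n x ≡ x))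

HasLeastPeriod : {A : Set} → (A → A) → ℕ → A → Set
HasLeastPeriod R n x = (iter R n x ≡ x) × (∀ m → 1 ≤ m → m < n → iter R m x ≢ x)

SameOrbit : {A : Set} → (A → A) → A → A → Set
SameOrbit R x y = ∃ λ k → iter R k x ≡ y

-- 𝒪_R(n) = k : there are exactly k closed orbits of length n, i.e. a
-- system of k representatives, one from each such orbit
OrbitCount : {A : Set} → (A → A) → ℕ → ℕ → Set
OrbitCount {A} R n k =
  Σ (Vec A k) λ v →
      (∀ i → HasLeastPeriod R n (lookup v i))
    × (∀ i j → SameOrbit R (lookup v i) (lookup v j) → i ≡ j)
    × (∀ x → HasLeastPeriod R n x → ∃ λ i → SameOrbit R (lookup v i) x)

-- some prime of P divides n  (s_P(n) = 0 iff this holds)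
DivisibleByPrimeIn : (ℕ → Set) → ℕ → Set
DivisibleByPrimeIn P n = ∃ λ p → Prime p × P p × p ∣ n

OrbitCountIsS : {A : Set} → (A → A) → (ℕ → Set) → Set
OrbitCountIsS R P =
  ∀ n → 1 ≤ n →
      (DivisibleByPrimeIn P n → OrbitCount R n 0)
    × (¬ DivisibleByPrimeIn P n → OrbitCount R n 1)

compl : (ℕ → Set) → ℕ → Set
compl P p = ¬ P p

module Submission where

-- The proof rests on one observation (leastPeriods-coprime): if x has least
-- S-period a and y has least T-period b, then a and b are coprime.  Indeed
-- (x , y) and (x , T y) have the same least period N, hence lie on the unique
-- orbit of length N, so S^K x = x and T^K y = T y for some K; then a ∣ K and
-- b ∣ K + (b - 1), and every common divisor of a and b divides 1.
-- Consequently a prime p is an orbit length of S or of T but never of both,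
-- and it is one of them because the orbit of length p of S × T projects to
-- an orbit of length p in some factor.  Given n, the representative (x , y)
-- of the unique orbit of length n then has x fixed when no prime of P
-- divides n (every prime factor of x's least period would lie in P), so y
-- has least period n and every T-orbit of length n is the projection of the
-- S × T-orbit; if some prime of P divides n, coprimality excludes T-orbits
-- of length n altogether.  The statement for S is symmetric.
--
-- Least periods exist only classically here (equality on the underlying sets
-- is not decidable), so they are used under double negation, which suffices
-- because all statements about them are negative.

open import Defs
open import Data.Nat using (ℕ; zero; suc; _+_; _*_; _<_; _≤_; _%_; _/_; NonZero; NonTrivial; z≤n; s≤s; nonTrivial⇒≢1; nonTrivial⇒nonZero; >-nonZero; >-nonZero⁻¹)
open import Data.Nat.Properties
open import Data.Nat.Divisibility using (_∣_; ∣-refl; ∣-trans; ∣1⇒≡1; ∣m+n∣m⇒∣n; m%n≡0⇒n∣m; ∣⇒≤)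
open import Data.Nat.DivMod using (m≡m%n+[m/n]*n; m%n<n)
open import Data.Nat.Coprimality using (Coprime)
open import Data.Nat.Induction using (<-rec)
open import Data.Nat.Primality using (Prime; prime⇒nonTrivial; prime⇒nonZero; prime⇒irreducible)
open import Data.Nat.Primality.Factorisation using (factorise)
open import Data.Nat.ListAction.Properties using (∈⇒∣product)
open import Data.List using ([]; _∷_)
open import Data.List.Relation.Unary.All using (_∷_)
open import Data.List.Relation.Unary.Any using (here)
import Data.Fin as Fin
open import Data.Vec using ([]; _∷_; lookup)
open import Data.Product using (Σ; ∃; _×_; _,_; proj₁; proj₂)
open import Data.Sum using ([_,_]′)
open import Data.Empty using (⊥; ⊥-elim)
open import Relation.Nullary using (¬_; yes; no)
open import Relation.Nullary.Decidable using (¬¬-excluded-middle; decidable-stable)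
open import Relation.Binary.PropositionalEquality using (_≡_; refl; sym; trans; cong; cong₂; subst; module ≡-Reasoning)

primeDivisor : ∀ n → .{{NonTrivial n}} → ∃ λ q → Prime q × q ∣ n
primeDivisor n with factorise n {{nonTrivial⇒nonZero n}}
... | record { factors = [] ; isFactorisation = n≡1 } = ⊥-elim (nonTrivial⇒≢1 n≡1)
... | record { factors = q ∷ qs ; isFactorisation = n≡Πqs ; factorsPrime = q-prime ∷ _ } =
  q , q-prime , subst (q ∣_) (sym n≡Πqs) (∈⇒∣product {ns = q ∷ qs} (here refl))

prime-positive : ∀ {p} → Prime p → 1 ≤ p
prime-positive {p} p-prime = >-nonZero⁻¹ p {{prime⇒nonZero p-prime}}

Period : {A : Set} → (A → A) → ℕ → A → Set
Period R n x = iter R n x ≡ x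

HasOrbitOfLength : {A : Set} → (A → A) → ℕ → Set
HasOrbitOfLength R n = ∃ λ x → HasLeastPeriod R n x

module Iteration {A : Set} (R : A → A) where

  iter-+ : ∀ m n x → iter R (m + n) x ≡ iter R m (iter R n x)
  iter-+ zero    n x = refl
  iter-+ (suc m) n x = cong R (iter-+ m n x)

  iter-comm : ∀ m n x → iter R m (iter R n x) ≡ iter R n (iter R m x)
  iter-comm m n x = begin
    iter R m (iter R n x) ≡⟨ iter-+ m n x ⟨
    iter R (m + n) x      ≡⟨ cong (λ k → iter R k x) (+-comm m n) ⟩
    iter R (n + m) x      ≡⟨ iter-+ n m x ⟩
    iter R n (iter R m x) ∎
    where open ≡-Reasoning

  period-* : ∀ n {x} → Period R n x → ∀ k → Period R (k * n) x
  period-* n e zero = refl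
  period-* n {x} e (suc k) = trans (iter-+ n (k * n) x) (trans (cong (iter R n) (period-* n e k)) e)

  fixed⇒period : ∀ {x} → R x ≡ x → ∀ n → Period R n x
  fixed⇒period e zero    = refl
  fixed⇒period e (suc n) = trans (cong R (fixed⇒period e n)) e

  period-image : ∀ m {y} → Period R m y → Period R m (R y)
  period-image m {y} e = trans (iter-comm m 1 y) (cong R e)

  period-preimage : ∀ b m {y} → Period R (suc b) y → Period R m (R y) → Period R m y
  period-preimage b m {y} e h = begin
    iter R m y                    ≡⟨ cong (iter R m) back ⟨
    iter R m (iter R b (R y))     ≡⟨ iter-comm m b (R y) ⟩
    iter R b (iter R m (R y))     ≡⟨ cong (iter R b) h ⟩
    iter R b (R y)                ≡⟨ back ⟩
    y                             ∎
    where
    open ≡-Reasoning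
    back : iter R b (R y) ≡ y
    back = trans (iter-comm b 1 y) e

  iter-% : ∀ {x} n .{{_ : NonZero n}} → Period R n x → ∀ k → iter R (k % n) x ≡ iter R k x
  iter-% {x} n e k = begin
    iter R (k % n) x                        ≡⟨ cong (iter R (k % n)) (period-* n e (k / n)) ⟨
    iter R (k % n) (iter R (k / n * n) x)   ≡⟨ iter-+ (k % n) (k / n * n) x ⟨
    iter R (k % n + k / n * n) x            ≡⟨ cong (λ j → iter R j x) (m≡m%n+[m/n]*n k n) ⟨
    iter R k x                              ∎
    where open ≡-Reasoning

  leastPeriod-∣ : ∀ {a x K} → 1 ≤ a → HasLeastPeriod R a x → Period R K x → a ∣ K
  leastPeriod-∣ {suc a} {x} {K} _ (ea , least) eK with K % suc a in K%a
  ... | zero  = m%n≡0⇒n∣m K (suc a) K%a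
  ... | suc r = ⊥-elim (least (suc r) (s≤s z≤n) (subst (_< suc a) K%a (m%n<n K (suc a)))
                  (trans (cong (λ j → iter R j x) (sym K%a)) (trans (iter-% (suc a) ea K) eK)))

  leastPeriod-∣-shifted : ∀ {b y K} → HasLeastPeriod R (suc b) y → iter R K y ≡ R y → suc b ∣ b + K
  leastPeriod-∣-shifted {b} {y} {K} lp e = leastPeriod-∣ (s≤s z≤n) lp (begin
    iter R (b + K) y      ≡⟨ iter-+ b K y ⟩
    iter R b (iter R K y) ≡⟨ cong (iter R b) e ⟩
    iter R b (R y)        ≡⟨ iter-comm b 1 y ⟩
    iter R (suc b) y      ≡⟨ proj₁ lp ⟩
    y                     ∎)
    where open ≡-Reasoning

  leastPeriod-exists : ∀ {n x} → 1 ≤ n → Period R n x → ¬ ¬ (∃ λ k → 1 ≤ k × HasLeastPeriod R k x)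
  leastPeriod-exists {n} {x} = <-rec Goal step n
    where
    Goal : ℕ → Set
    Goal n = 1 ≤ n → Period R n x → ¬ ¬ (∃ λ k → 1 ≤ k × HasLeastPeriod R k x)
    step : ∀ n → (∀ {m} → m < n → Goal m) → Goal n
    step n smaller 1≤n e noLeast = ¬¬-excluded-middle {A = ShorterPeriod} λ
      { (yes (m , 1≤m , m<n , em)) → smaller m<n 1≤m em noLeast
      ; (no none) → noLeast (n , 1≤n , e , λ m 1≤m m<n em → none (m , 1≤m , m<n , em)) }
      where
      ShorterPeriod : Set
      ShorterPeriod = ∃ λ m → 1 ≤ m × m < n × Period R m x

  leastPeriod-prime : ∀ {p x} → Prime p → Period R p x → ¬ R x ≡ x → HasLeastPeriod R p x
  leastPeriod-prime {p} {x} p-prime ep notFixed = ep , λ m 1≤m m<p em →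
    leastPeriod-exists 1≤m em λ (j , 1≤j , lp) →
      -- the least period j divides the prime p, so j = 1 or j = p ∣ m < p
      [ (λ j≡1 → notFixed (subst (λ i → Period R i x) j≡1 (proj₁ lp)))
      , (λ j≡p → <-irrefl j≡p (<-≤-trans (s≤s (∣⇒≤ {{>-nonZero 1≤m}} (leastPeriod-∣ 1≤j lp em))) m<p))
      ]′ (prime⇒irreducible p-prime (leastPeriod-∣ 1≤j lp ep))

  fixed-unless-primePeriod : ∀ {n x} → 1 ≤ n → Period R n x →
    (∀ {i q} → 1 ≤ i → HasLeastPeriod R i x → Prime q → q ∣ i → ⊥) → ¬ ¬ (R x ≡ x)
  fixed-unless-primePeriod 1≤n e noPrime notFixed =
    leastPeriod-exists 1≤n e λ
      { (suc zero    , _   , lp) → notFixed (proj₁ lp)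
      ; (suc (suc i) , 1≤i , lp) → let (q , q-prime , q∣i) = primeDivisor (suc (suc i))
                                   in noPrime 1≤i lp q-prime q∣i }

  sameOrbit-sym : ∀ {N r z} → Period R (suc N) r → SameOrbit R r z → SameOrbit R z r
  sameOrbit-sym {N} {r} er (k , refl) = k * N , (begin
    iter R (k * N) (iter R k r) ≡⟨ iter-+ (k * N) k r ⟨
    iter R (k * N + k) r        ≡⟨ cong (λ j → iter R j r) (trans (+-comm (k * N) k) (sym (*-suc k N))) ⟩
    iter R (k * suc N) r        ≡⟨ period-* (suc N) er k ⟩
    r                           ∎)
    where open ≡-Reasoning

  sameOrbit-trans : ∀ {x y z} → SameOrbit R x y → SameOrbit R y z → SameOrbit R x z
  sameOrbit-trans {x} (k , refl) (l , refl) = l + k , iter-+ l k x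

open Iteration

orbitCount-one : ∀ {A : Set} {R : A → A} {n r} → HasLeastPeriod R n r →
  (∀ z → HasLeastPeriod R n z → SameOrbit R r z) → OrbitCount R n 1
orbitCount-one {r = r} lp covers =
  r ∷ [] , (λ { Fin.zero → lp }) , (λ { Fin.zero Fin.zero _ → refl }) ,
  λ z lpz → Fin.zero , covers z lpz

orbitCount-zero : ∀ {A : Set} {R : A → A} {n} → (∀ z → ¬ HasLeastPeriod R n z) → OrbitCount R n 0
orbitCount-zero none = [] , (λ ()) , (λ ()) , λ z lpz → ⊥-elim (none z lpz)

orbitCount-one⇒unique : ∀ {A : Set} {R : A → A} {n} → OrbitCount R n 1 →
  ∃ λ r → HasLeastPeriod R n r × (∀ z → HasLeastPeriod R n z → SameOrbit R r z)
orbitCount-one⇒unique {R = R} (r ∷ [] , lp , _ , covers) = r , lp Fin.zero , λ z lpz → cover (covers z lpz)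
  where
  cover : ∀ {z} → ∃ (λ i → SameOrbit R (lookup (r ∷ []) i) z) → SameOrbit R r z
  cover (Fin.zero , o) = o

module Product {A B : Set} (S : A → A) (T : B → B) where

  iter-⊗ : ∀ k x y → iter (S ⊗ T) k (x , y) ≡ (iter S k x , iter T k y)
  iter-⊗ zero    x y = refl
  iter-⊗ (suc k) x y = cong (S ⊗ T) (iter-⊗ k x y)

  period-⊗ : ∀ m {x y} → Period S m x → Period T m y → Period (S ⊗ T) m (x , y)
  period-⊗ m {x} {y} ex ey = trans (iter-⊗ m x y) (cong₂ _,_ ex ey)

  period-fst : ∀ m {x y} → Period (S ⊗ T) m (x , y) → Period S m x
  period-fst m {x} {y} e = cong proj₁ (trans (sym (iter-⊗ m x y)) e)

  period-snd : ∀ m {x y} → Period (S ⊗ T) m (x , y) → Period T m y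
  period-snd m {x} {y} e = cong proj₂ (trans (sym (iter-⊗ m x y)) e)

  leastPeriod-⊗ : ∀ {n x y} → Period S n x → Period T n y →
    (∀ {m} → 1 ≤ m → m < n → Period S m x → Period T m y → ⊥) → HasLeastPeriod (S ⊗ T) n (x , y)
  leastPeriod-⊗ {n} ex ey noCommon =
    period-⊗ n ex ey , λ m 1≤m m<n e → noCommon 1≤m m<n (period-fst m e) (period-snd m e)

  leastPeriod-fixedFst : ∀ {n x y} → S x ≡ x → HasLeastPeriod T n y → HasLeastPeriod (S ⊗ T) n (x , y)
  leastPeriod-fixedFst {n} fx (ey , least) =
    leastPeriod-⊗ (fixed⇒period S fx n) ey λ {m} 1≤m m<n _ → least m 1≤m m<n

  leastPeriod-fixedSnd : ∀ {n x y} → T y ≡ y → HasLeastPeriod S n x → HasLeastPeriod (S ⊗ T) n (x , y)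
  leastPeriod-fixedSnd {n} fy (ex , least) =
    leastPeriod-⊗ ex (fixed⇒period T fy n) λ {m} 1≤m m<n ex' _ → least m 1≤m m<n ex'

  leastPeriod-snd : ∀ {n x y} → HasLeastPeriod (S ⊗ T) n (x , y) → ¬ ¬ (S x ≡ x) → HasLeastPeriod T n y
  leastPeriod-snd {n} (e , least) fixed = period-snd n e , λ m 1≤m m<n ey →
    fixed λ fx → least m 1≤m m<n (period-⊗ m (fixed⇒period S fx m) ey)

  leastPeriod-fst : ∀ {n x y} → HasLeastPeriod (S ⊗ T) n (x , y) → ¬ ¬ (T y ≡ y) → HasLeastPeriod S n x
  leastPeriod-fst {n} (e , least) fixed = period-fst n e , λ m 1≤m m<n ex →
    fixed λ fy → least m 1≤m m<n (period-⊗ m ex (fixed⇒period T fy m))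

  sameOrbit-fst : ∀ {x y x' y'} → SameOrbit (S ⊗ T) (x , y) (x' , y') → SameOrbit S x x'
  sameOrbit-fst {x} {y} (k , e) = k , cong proj₁ (trans (sym (iter-⊗ k x y)) e)

  sameOrbit-snd : ∀ {x y x' y'} → SameOrbit (S ⊗ T) (x , y) (x' , y') → SameOrbit T y y'
  sameOrbit-snd {x} {y} (k , e) = k , cong proj₂ (trans (sym (iter-⊗ k x y)) e)

module UniqueOrbits {A B : Set} (S : A → A) (T : B → B)
  (unique : ∀ n → 1 ≤ n → OrbitCount (S ⊗ T) n 1) where

  open Product S T

  rep : ∀ n → 1 ≤ n → A × B
  rep n h = proj₁ (orbitCount-one⇒unique (unique n h))

  rep-leastPeriod : ∀ n h → HasLeastPeriod (S ⊗ T) n (rep n h)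
  rep-leastPeriod n h = proj₁ (proj₂ (orbitCount-one⇒unique (unique n h)))

  rep-covers : ∀ n h z → HasLeastPeriod (S ⊗ T) n z → SameOrbit (S ⊗ T) (rep n h) z
  rep-covers n h = proj₂ (proj₂ (orbitCount-one⇒unique (unique n h)))

  sameLeastPeriod⇒sameOrbit : ∀ {N z z'} → HasLeastPeriod (S ⊗ T) (suc N) z →
    HasLeastPeriod (S ⊗ T) (suc N) z' → SameOrbit (S ⊗ T) z z'
  sameLeastPeriod⇒sameOrbit {N} {z} {z'} lp lp' = sameOrbit-trans (S ⊗ T)
    (sameOrbit-sym (S ⊗ T) {N} (proj₁ (rep-leastPeriod (suc N) h)) (rep-covers (suc N) h z lp))
    (rep-covers (suc N) h z' lp')
    where
    h : 1 ≤ suc N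
    h = s≤s z≤n

  fixedS : A
  fixedS = proj₁ (rep 1 (s≤s z≤n))

  fixedT : B
  fixedT = proj₂ (rep 1 (s≤s z≤n))

  fixedS-fixed : S fixedS ≡ fixedS
  fixedS-fixed = period-fst 1 (proj₁ (rep-leastPeriod 1 (s≤s z≤n)))

  fixedT-fixed : T fixedT ≡ fixedT
  fixedT-fixed = period-snd 1 (proj₁ (rep-leastPeriod 1 (s≤s z≤n)))

  leastPeriods-coprime : ∀ {a b x y} → 1 ≤ a → 1 ≤ b →
    HasLeastPeriod S a x → HasLeastPeriod T b y → Coprime a b
  leastPeriods-coprime {a} {suc b} {x} {y} 1≤a 1≤b lpx lpy {d} (d∣a , d∣b) =
    decidable-stable (d ≟ 1) λ d≢1 →
      leastPeriod-exists (S ⊗ T) (*-mono-≤ 1≤b 1≤a) commonPeriod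
        λ { (suc N , _ , lpxy) → d≢1 (∣1⇒≡1 (commonDivisor∣1 (shiftedOrbit lpxy))) }
    where
    commonPeriod : Period (S ⊗ T) (suc b * a) (x , y)
    commonPeriod = period-⊗ (suc b * a) (period-* S a (proj₁ lpx) (suc b))
      (subst (λ j → Period T j y) (*-comm a (suc b)) (period-* T (suc b) (proj₁ lpy) a))

    -- (x , T y) has the same least period as (x , y), so it lies on the same orbit.
    shiftedOrbit : ∀ {N} → HasLeastPeriod (S ⊗ T) (suc N) (x , y) → SameOrbit (S ⊗ T) (x , y) (x , T y)
    shiftedOrbit {N} lpxy@(e , least) = sameLeastPeriod⇒sameOrbit lpxy
      (leastPeriod-⊗ (period-fst (suc N) e) (period-image T (suc N) (period-snd (suc N) e))
        λ {m} 1≤m m<N ex ey → least m 1≤m m<N (period-⊗ m ex (period-preimage T b m (proj₁ lpy) ey)))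

    -- From S^K x = x and T^K y = T y: d ∣ a ∣ K and d ∣ 1 + b ∣ b + K, so d ∣ b and d ∣ 1.
    commonDivisor∣1 : SameOrbit (S ⊗ T) (x , y) (x , T y) → d ∣ 1
    commonDivisor∣1 (K , e) = ∣m+n∣m⇒∣n (subst (d ∣_) (+-comm 1 b) d∣b) d∣b-1
      where
      d∣K : d ∣ K
      d∣K = ∣-trans d∣a (leastPeriod-∣ S 1≤a lpx (proj₂ (sameOrbit-fst (K , e))))
      d∣b+K : d ∣ b + K
      d∣b+K = ∣-trans d∣b (leastPeriod-∣-shifted T lpy (proj₂ (sameOrbit-snd (K , e))))
      d∣b-1 : d ∣ b
      d∣b-1 = ∣m+n∣m⇒∣n (subst (d ∣_) (+-comm b K) d∣b+K) d∣K

  noCommonPrime : ∀ {a b x y q} → 1 ≤ a → 1 ≤ b → HasLeastPeriod S a x → HasLeastPeriod T b y →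
    Prime q → q ∣ a → q ∣ b → ⊥
  noCommonPrime 1≤a 1≤b lpx lpy q-prime q∣a q∣b =
    nonTrivial⇒≢1 {{prime⇒nonTrivial q-prime}} (leastPeriods-coprime 1≤a 1≤b lpx lpy (q∣a , q∣b))

  -- Every prime is an orbit length of S or of T: project the orbit of length p of S × T.
  primeOrbit-T : ∀ {p} → Prime p → ¬ HasOrbitOfLength S p → HasOrbitOfLength T p
  primeOrbit-T {p} p-prime noS = proj₂ (rep p h) , leastPeriod-snd lp λ notFixed →
      noS (proj₁ (rep p h) , leastPeriod-prime S p-prime (period-fst p (proj₁ lp)) notFixed)
    where
    h : 1 ≤ p
    h = prime-positive p-prime
    lp : HasLeastPeriod (S ⊗ T) p (rep p h)
    lp = rep-leastPeriod p h

  primeDivisor-S : ∀ {i x q} → 1 ≤ i → HasLeastPeriod S i x → Prime q → q ∣ i → ¬ ¬ HasOrbitOfLength S q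
  primeDivisor-S 1≤i lpx q-prime q∣i notS =
    let (y , lpy) = primeOrbit-T q-prime notS
    in noCommonPrime 1≤i (prime-positive q-prime) lpx lpy q-prime q∣i ∣-refl

  primeDivisor-T : ∀ {j y q} → 1 ≤ j → HasLeastPeriod T j y → Prime q → q ∣ j → ¬ HasOrbitOfLength S q
  primeDivisor-T 1≤j lpy q-prime q∣j (x , lpx) =
    noCommonPrime (prime-positive q-prime) 1≤j lpx lpy q-prime ∣-refl q∣j

  -- If no prime of P divides n, the S-component of the orbit of length n is fixed
  -- (its least period has no prime divisor), so the T-component has least period n.
  rep-snd-leastPeriod : ∀ {n} (h : 1 ≤ n) → ¬ DivisibleByPrimeIn (HasOrbitOfLength S) n →
    HasLeastPeriod T n (proj₂ (rep n h))
  rep-snd-leastPeriod {n} h notDiv = leastPeriod-snd lp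
    (fixed-unless-primePeriod S h ex λ 1≤i lpx q-prime q∣i →
      primeDivisor-S 1≤i lpx q-prime q∣i λ Sq →
        notDiv (_ , q-prime , Sq , ∣-trans q∣i (leastPeriod-∣ S 1≤i lpx ex)))
    where
    lp : HasLeastPeriod (S ⊗ T) n (rep n h)
    lp = rep-leastPeriod n h
    ex : Period S n (proj₁ (rep n h))
    ex = period-fst n (proj₁ lp)

  -- Symmetrically, if no prime of Pᶜ divides n, the T-component is fixed
  -- (each prime divisor of its least period lies outside P).
  rep-fst-leastPeriod : ∀ {n} (h : 1 ≤ n) → ¬ DivisibleByPrimeIn (compl (HasOrbitOfLength S)) n →
    HasLeastPeriod S n (proj₁ (rep n h))
  rep-fst-leastPeriod {n} h notDiv = leastPeriod-fst lp
    (fixed-unless-primePeriod T h ey λ 1≤j lpy q-prime q∣j →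
      notDiv (_ , q-prime , primeDivisor-T 1≤j lpy q-prime q∣j , ∣-trans q∣j (leastPeriod-∣ T 1≤j lpy ey)))
    where
    lp : HasLeastPeriod (S ⊗ T) n (rep n h)
    lp = rep-leastPeriod n h
    ey : Period T n (proj₂ (rep n h))
    ey = period-snd n (proj₁ lp)

  -- 𝒪_T = s_P: orbits of length n are excluded by coprimality when a prime of P
  -- divides n, and otherwise are all projections of the single orbit of S × T.
  orbitsOfT : OrbitCountIsS T (HasOrbitOfLength S)
  orbitsOfT n h = none , one
    where
    none : DivisibleByPrimeIn (HasOrbitOfLength S) n → OrbitCount T n 0
    none (p , p-prime , Sp , p∣n) = orbitCount-zero λ y lpy → primeDivisor-T h lpy p-prime p∣n Sp

    one : ¬ DivisibleByPrimeIn (HasOrbitOfLength S) n → OrbitCount T n 1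
    one notDiv = orbitCount-one (rep-snd-leastPeriod h notDiv) λ y lpy →
      sameOrbit-snd (rep-covers n h (fixedS , y) (leastPeriod-fixedFst fixedS-fixed lpy))

  orbitsOfS : OrbitCountIsS S (compl (HasOrbitOfLength S))
  orbitsOfS n h = none , one
    where
    none : DivisibleByPrimeIn (compl (HasOrbitOfLength S)) n → OrbitCount S n 0
    none (p , p-prime , notSp , p∣n) = orbitCount-zero λ x lpx → primeDivisor-S h lpx p-prime p∣n notSp

    one : ¬ DivisibleByPrimeIn (compl (HasOrbitOfLength S)) n → OrbitCount S n 1
    one notDiv = orbitCount-one (rep-fst-leastPeriod h notDiv) λ x lpx →
      sameOrbit-fst (rep-covers n h (x , fixedT) (leastPeriod-fixedSnd fixedT-fixed lpx))

proposition3p1 : {A B : Set} (S : A → A) (T : B → B) →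
    FinitelyManyFixedPoints S → FinitelyManyFixedPoints T →
    (∀ n → 1 ≤ n → OrbitCount (S ⊗ T) n 1) →
    Σ (ℕ → Set) λ P → OrbitCountIsS T P × OrbitCountIsS S (compl P)
proposition3p1 S T _ _ uniqueOrbits = HasOrbitOfLength S , orbitsOfT , orbitsOfS
  where open UniqueOrbits S T uniqueOrbits
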